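{- Let $p$ be a prime and let $q=p^\alpha$ with $\alpha>0$ an integer. Let $k\geq 2$ be an integer. Let $L\subseteq\{0,1,\ldots,q-1\}$ be a proper subset with $|L|=s>0$. Let $n$ be a positive integer and let $\mathcal F\subseteq 2^{[n]}$ be a family of subsets of $[n]$ such that for every $F\in\mathcal F$, $|F|\not\equiv \ell\pmod q$ for all $\ell\in L$, and such that for any $k$ distinct sets $F_1,\ldots,F_k\in\mathcal F$ there exists $\ell\in L$ with $|F_1\cap\cdots\cap F_k|\equiv \ell\pmod q$. Then $$|\mathcal F|\leq (k-1)\sum_{j=0}^{q-1}\binom{n}{j}.$$
   Context: $2^{[n]}$ denotes the family of all subsets of $[n]=\{1,\ldots,n\}$. -}

module Defs where

open import Data.Nat using (ℕ; zero; suc; _+_; _*_)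
open import Data.Nat.Combinatorics using (_C_)
open import Data.Product using (∃-syntax)
open import Data.Fin using (Fin)
open import Data.Fin.Subset using (Subset; ⊤; _∩_)
open import Data.Vec.Functional using (foldr)
open import Relation.Binary.PropositionalEquality using (_≡_)

_≡_[mod_] : ℕ → ℕ → ℕ → Set
a ≡ b [mod q ] = ∃[ x ] ∃[ y ] (a + x * q ≡ b + y * q)

⋂ : ∀ {n k} → (Fin k → Subset n) → Subset n
⋂ {n} {k} G = foldr _∩_ ⊤ G

binomSum : ℕ → ℕ → ℕ
binomSum n zero = 0
binomSum n (suc m) = binomSum n m + n C m

{-# OPTIONS --safe #-}
module Submission where

-- Split 𝓕 greedily into blocks: start a block with any remaining set and keep intersecting it
-- with further remaining sets as long as the size of the intersection avoids L modulo q.  Since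
-- any k members of 𝓕 meet in a size lying in L, a block never exceeds k - 1 members, and once it
-- is closed every remaining set meets its intersection in a size lying in L.  Block i yields a
-- test set yᵢ (a member of the block) and a support Yᵢ (the intersection of the block) with
-- |yᵢ ∩ Yᵢ| avoiding L modulo q, but |yⱼ ∩ Yᵢ| in L modulo q for all later blocks j.
--
-- Since p divides C(q, t) for 0 < t < q, the sequence m ↦ C(m, t) is q-periodic modulo p for
-- t < q.  Newton interpolation therefore gives b with Σ_{t<q} b_t C(m, t) ≡ [m mod q ∉ L]
-- (mod p) for all m.  The polynomials fᵢ(x) = Σ_{T ⊆ Yᵢ, |T| < q} b_{|T|} x_T, in the span of
-- the N = Σ_{t<q} C(n, t) monomials x_T, satisfy fᵢ(yⱼ) = Σ_{t<q} b_t C(|yⱼ ∩ Yᵢ|, t).  This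
-- matrix is triangular with nonzero diagonal modulo p, so the fᵢ are linearly independent over
-- 𝔽_p and there are at most N blocks.  Independence is shown by counting: c ↦ Σᵢ cᵢ fᵢ is an
-- injection of 𝔽_p^s into 𝔽_p^N.

open import Data.Bool using (if_then_else_)
open import Data.Fin using (Fin; zero; suc; toℕ; fromℕ; inject₁; funToFin; finToFun; combine)
import Data.Fin as Fin
open import Data.Fin.Properties
  using (any?; injective⇒≤; funToFin-finToFin; finToFun-funToFin; toℕ-injective; toℕ-fromℕ<; toℕ<n; toℕ-inject₁; toℕ-fromℕ)
open import Data.Fin.Subset using (Subset; inside; outside; ∣_∣; _∩_; _∈_; _∉_; _⊆_; _-_; ⁅_⁆; ⊤)
open import Data.Fin.Subset.Properties
  using (_∈?_; nonempty?; Empty-unique; ∣⊥∣≡0; ∣⊤∣≡n; p─⊥≡p; p─q⊆p; p⊆q⇒∣p∣≤∣q∣; x∈p⇒∣p-x∣<∣p∣; ∩-assoc; ∩-idem; ∩-identityʳ)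
open import Data.List using (List; []; _∷_; _++_; map; length; lookup)
open import Data.List.Membership.Propositional using (find) renaming (_∈_ to _∈ˡ_)
open import Data.List.Membership.Propositional.Properties using (∈-lookup)
open import Data.List.Properties using (map-++; map-∘; length-++; length-map)
open import Data.List.Relation.Unary.All using (All)
import Data.List.Relation.Unary.All as All
open import Data.List.Relation.Unary.Any using (Any)
open import Data.List.Relation.Unary.Unique.Propositional using (Unique)
open import Data.Nat
  using (ℕ; zero; suc; _+_; _*_; _∸_; _^_; _%_; _/_; _≤_; _<_; pred; NonZero; s≤s; z<s; s<s; >-nonZero⁻¹; nonTrivial⇒n>1)
open import Data.Nat.Combinatorics using (_C_; nC1≡n; nCk+nC[k+1]≡[n+1]C[k+1])
open import Data.Nat.Divisibility
  using (_∣_; divides; _∣?_; 1∣_; ∣-trans; m∣m*n; *-monoʳ-∣; *-cancelˡ-∣; ∣⇒≤; m%n≡0⇒n∣m; n∣m⇒m%n≡0)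
open import Data.Nat.DivMod
  using (_mod_; m≡m%n+[m/n]*n; %-distribˡ-+; %-distribˡ-*; [m+kn]%n≡m%n; m*n%n≡0; m<n⇒m%n≡m; m%n<n)
open import Data.Nat.Induction using (<-wellFounded)
open import Data.Nat.ListAction using () renaming (sum to sumˡ)
open import Data.Nat.ListAction.Properties using (sum-++)
open import Data.Nat.Primality using (Prime; euclidsLemma; prime⇒nonZero; prime⇒nonTrivial)
open import Data.Nat.Properties
open import Data.List.Membership.DecPropositional _≟_ using () renaming (_∈?_ to _∈ˡ?_)
open import Algebra.Properties.CommutativeSemigroup +-commutativeSemigroup
  using () renaming (x∙yz≈y∙xz to x+[y+z]≡y+[x+z])
open import Algebra.Properties.Semiring.Sum +-*-semiring
  using (sum; sum-syntax; sum-cong-≗; sum-init-last; sum-replicate-zero; ∑-comm; ∑-distrib-+; *-distribˡ-sum; *-distribʳ-sum)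
open import Data.Product using (_,_)
open import Data.Sum using (_⊎_; inj₁; inj₂; [_,_]′)
open import Data.Vec using ([]; _∷_; there)
open import Data.Vec.Functional using () renaming (_∷_ to _∷ᶠ_)
open import Function using (_∘_; id)
open import Function.Definitions using (Injective)
open import Induction.WellFounded using (Acc; acc)
open import Relation.Binary.Bundles using (Setoid)
import Relation.Binary.Reasoning.Setoid as SetoidReasoning
open import Relation.Binary.PropositionalEquality
  using (_≡_; _≢_; _≗_; refl; sym; trans; cong; cong₂; subst; module ≡-Reasoning)
open import Relation.Binary.Structures using (IsEquivalence)
open import Relation.Nullary using (¬_; contradiction; yes; no; does; ¬?; _×-dec_)
open import Relation.Nullary.Decidable using (dec-true; dec-false; decidable-stable)
open import Relation.Unary using (Decidable)

open import Defs using (_≡_[mod_]; ⋂; binomSum)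

module Congruence (d : ℕ) .{{_ : NonZero d}} where

  infix 4 _≈_ _≉_

  record _≈_ (a b : ℕ) : Set where
    constructor mod-≡
    field %-≡ : a % d ≡ b % d

  _≉_ : ℕ → ℕ → Set
  a ≉ b = ¬ a ≈ b

  ≈-reflexive : ∀ {a b} → a ≡ b → a ≈ b
  ≈-reflexive refl = mod-≡ refl

  ≈-isEquivalence : IsEquivalence _≈_
  ≈-isEquivalence = record
    { refl  = mod-≡ refl
    ; sym   = λ (mod-≡ e) → mod-≡ (sym e)
    ; trans = λ (mod-≡ e) (mod-≡ f) → mod-≡ (trans e f)
    }

  ≈-setoid : Setoid _ _
  ≈-setoid = record { isEquivalence = ≈-isEquivalence }

  open IsEquivalence ≈-isEquivalence public
    using () renaming (refl to ≈-refl; sym to ≈-sym; trans to ≈-trans)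

  module ≈-Reasoning = SetoidReasoning ≈-setoid

  +-cong : ∀ {a a′ b b′} → a ≈ a′ → b ≈ b′ → a + b ≈ a′ + b′
  +-cong {a} {a′} {b} {b′} (mod-≡ e) (mod-≡ f) = mod-≡ (begin
    (a + b) % d             ≡⟨ %-distribˡ-+ a b d ⟩
    (a % d + b % d) % d     ≡⟨ cong₂ (λ x y → (x + y) % d) e f ⟩
    (a′ % d + b′ % d) % d   ≡⟨ %-distribˡ-+ a′ b′ d ⟨
    (a′ + b′) % d           ∎)
    where open ≡-Reasoning

  *-cong : ∀ {a a′ b b′} → a ≈ a′ → b ≈ b′ → a * b ≈ a′ * b′
  *-cong {a} {a′} {b} {b′} (mod-≡ e) (mod-≡ f) = mod-≡ (begin
    (a * b) % d               ≡⟨ %-distribˡ-* a b d ⟩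
    (a % d * (b % d)) % d     ≡⟨ cong₂ (λ x y → (x * y) % d) e f ⟩
    (a′ % d * (b′ % d)) % d   ≡⟨ %-distribˡ-* a′ b′ d ⟨
    (a′ * b′) % d             ∎)
    where open ≡-Reasoning

  0%d≡0 : 0 % d ≡ 0
  0%d≡0 = m<n⇒m%n≡m (>-nonZero⁻¹ d)

  ∣⇒≈0 : ∀ {a} → d ∣ a → a ≈ 0
  ∣⇒≈0 {a} d∣a = mod-≡ (trans (n∣m⇒m%n≡0 a d d∣a) (sym 0%d≡0))

  ≈0⇒∣ : ∀ {a} → a ≈ 0 → d ∣ a
  ≈0⇒∣ {a} (mod-≡ e) = m%n≡0⇒n∣m a d (trans e 0%d≡0)

  1≉0 : 1 < d → 1 ≉ 0
  1≉0 1<d (mod-≡ e) = contradiction (trans (sym (m<n⇒m%n≡m 1<d)) (trans e 0%d≡0)) λ ()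

  negate : ℕ → ℕ
  negate a = pred d * a

  +-inverseʳ : ∀ a → a + negate a ≈ 0
  +-inverseʳ a = mod-≡ (begin
    (a + pred d * a) % d   ≡⟨ cong (λ x → (x * a) % d) (suc-pred d) ⟩
    (d * a) % d            ≡⟨ cong (_% d) (*-comm d a) ⟩
    (a * d) % d            ≡⟨ m*n%n≡0 a d ⟩
    0                      ≡⟨ 0%d≡0 ⟨
    0 % d                  ∎)
    where open ≡-Reasoning

  +-cancelʳ-≈ : ∀ {a a′ b b′} → b ≈ b′ → a + b ≈ a′ + b′ → a ≈ a′
  +-cancelʳ-≈ {a} {a′} {b} {b′} b≈b′ eq = begin
    a                       ≡⟨ +-identityʳ a ⟨
    a + 0                   ≈⟨ +-cong (≈-refl {a}) (+-inverseʳ b) ⟨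
    a + (b + negate b)      ≡⟨ +-assoc a b (negate b) ⟨
    a + b + negate b        ≈⟨ +-cong eq (*-cong (≈-refl {pred d}) b≈b′) ⟩
    a′ + b′ + negate b′     ≡⟨ +-assoc a′ b′ (negate b′) ⟩
    a′ + (b′ + negate b′)   ≈⟨ +-cong (≈-refl {a′}) (+-inverseʳ b′) ⟩
    a′ + 0                  ≡⟨ +-identityʳ a′ ⟩
    a′                      ∎
    where open ≈-Reasoning

  +-cancelˡ-≈ : ∀ {a a′ b b′} → a ≈ a′ → a + b ≈ a′ + b′ → b ≈ b′
  +-cancelˡ-≈ {a} {a′} {b} {b′} a≈a′ eq =
    +-cancelʳ-≈ a≈a′ (≈-trans (≈-reflexive (+-comm b a)) (≈-trans eq (≈-reflexive (+-comm a′ b′))))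

  sum-cong-≈ : ∀ {s} {f g : Fin s → ℕ} → (∀ i → f i ≈ g i) → sum f ≈ sum g
  sum-cong-≈ {zero}  _   = ≈-refl
  sum-cong-≈ {suc s} f≈g = +-cong (f≈g zero) (sum-cong-≈ (f≈g ∘ suc))

  mod-≡⇒≈ : ∀ {a b} → a mod d ≡ b mod d → a ≈ b
  mod-≡⇒≈ {a} {b} eq = mod-≡ (begin
    a % d           ≡⟨ toℕ-fromℕ< (m%n<n a d) ⟨
    toℕ (a mod d)   ≡⟨ cong toℕ eq ⟩
    toℕ (b mod d)   ≡⟨ toℕ-fromℕ< (m%n<n b d) ⟩
    b % d           ∎)
    where open ≡-Reasoning

  toℕ-≈-injective : ∀ {x y : Fin d} → toℕ x ≈ toℕ y → x ≡ y
  toℕ-≈-injective {x} {y} (mod-≡ e) = toℕ-injective (begin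
    toℕ x       ≡⟨ m<n⇒m%n≡m (toℕ<n x) ⟨
    toℕ x % d   ≡⟨ e ⟩
    toℕ y % d   ≡⟨ m<n⇒m%n≡m (toℕ<n y) ⟩
    toℕ y       ∎)
    where open ≡-Reasoning

  module _ (d-prime : Prime d) where

    *-cancelʳ-≤-≈ : ∀ {a b c} → c ≉ 0 → a ≤ b → a * c ≈ b * c → a ≈ b
    *-cancelʳ-≤-≈ {a} {b} {c} c≉0 a≤b eq with m≤n⇒∃[o]m+o≡n a≤b
    ... | e , refl = ≈-sym (≈-trans (+-cong (≈-refl {a}) e≈0) (≈-reflexive (+-identityʳ a)))
      where
      e*c≈0 : e * c ≈ 0
      e*c≈0 = +-cancelˡ-≈ (≈-refl {a * c}) (begin
        a * c + e * c   ≡⟨ *-distribʳ-+ c a e ⟨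
        (a + e) * c     ≈⟨ eq ⟨
        a * c           ≡⟨ +-identityʳ (a * c) ⟨
        a * c + 0       ∎)
        where open ≈-Reasoning
      e≈0 : e ≈ 0
      e≈0 with euclidsLemma e c d-prime (≈0⇒∣ e*c≈0)
      ... | inj₁ d∣e = ∣⇒≈0 d∣e
      ... | inj₂ d∣c = contradiction (∣⇒≈0 d∣c) c≉0

    *-cancelʳ-≈ : ∀ {a b c} → c ≉ 0 → a * c ≈ b * c → a ≈ b
    *-cancelʳ-≈ {a} {b} c≉0 eq with ≤-total a b
    ... | inj₁ a≤b = *-cancelʳ-≤-≈ c≉0 a≤b eq
    ... | inj₂ b≤a = ≈-sym (*-cancelʳ-≤-≈ c≉0 b≤a (≈-sym eq))

-- Linear algebra modulo a prime

infixl 7 _⋆_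

_⋆_ : ∀ {r N s} → (Fin r → Fin N → ℕ) → (Fin N → Fin s → ℕ) → Fin r → Fin s → ℕ
_⋆_ {N = N} A B i j = ∑[ t < N ] (A i t * B t j)

∑-*-⋆ : ∀ {r N s} (c : Fin r → ℕ) (A : Fin r → Fin N → ℕ) (B : Fin N → Fin s → ℕ) j →
        ∑[ t < N ] (∑[ i < r ] (c i * A i t) * B t j) ≡ ∑[ i < r ] (c i * (A ⋆ B) i j)
∑-*-⋆ {r} {N} c A B j = begin
  ∑[ t < N ] (∑[ i < r ] (c i * A i t) * B t j)
    ≡⟨ sum-cong-≗ {N} (λ t → *-distribʳ-sum (B t j) (λ i → c i * A i t)) ⟩
  ∑[ t < N ] ∑[ i < r ] (c i * A i t * B t j)
    ≡⟨ ∑-comm (λ t i → c i * A i t * B t j) ⟩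
  ∑[ i < r ] ∑[ t < N ] (c i * A i t * B t j)
    ≡⟨ sum-cong-≗ {r} (λ i → trans (sum-cong-≗ {N} (λ t → *-assoc (c i) (A i t) (B t j)))
                                   (sym (*-distribˡ-sum (c i) (λ t → A i t * B t j)))) ⟩
  ∑[ i < r ] (c i * (A ⋆ B) i j)
    ∎
  where open ≡-Reasoning

funToFin-cong : ∀ {m n} {f g : Fin m → Fin n} → f ≗ g → funToFin f ≡ funToFin g
funToFin-cong {zero}  _   = refl
funToFin-cong {suc m} f≗g = cong₂ combine (f≗g zero) (funToFin-cong (f≗g ∘ suc))

≗-injective⇒≤ : ∀ {m s N} → 1 < m → (Φ : (Fin s → Fin m) → (Fin N → Fin m)) → Injective _≗_ _≗_ Φ → s ≤ N
≗-injective⇒≤ {m} {s} {N} 1<m Φ Φ-injective =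
  ≮⇒≥ (λ N<s → <⇒≱ (^-monoʳ-< m 1<m N<s) (injective⇒≤ G-injective))
  where
  G : Fin (m ^ s) → Fin (m ^ N)
  G = funToFin ∘ Φ ∘ finToFun {m} {s}
  G-injective : Injective _≡_ _≡_ G
  G-injective {a} {b} Ga≡Gb = begin
    a                               ≡⟨ funToFin-finToFin {s} {m} a ⟨
    funToFin (finToFun {m} {s} a)   ≡⟨ funToFin-cong (Φ-injective Φa≗Φb) ⟩
    funToFin (finToFun {m} {s} b)   ≡⟨ funToFin-finToFin {s} {m} b ⟩
    b                               ∎
    where
    open ≡-Reasoning
    Φa≗Φb : Φ (finToFun a) ≗ Φ (finToFun b)
    Φa≗Φb t = begin
      Φ (finToFun a) t           ≡⟨ finToFun-funToFin (Φ (finToFun a)) t ⟨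
      finToFun {m} {N} (G a) t   ≡⟨ cong (λ x → finToFun {m} {N} x t) Ga≡Gb ⟩
      finToFun {m} {N} (G b) t   ≡⟨ finToFun-funToFin (Φ (finToFun b)) t ⟩
      Φ (finToFun b) t           ∎

module _ {p : ℕ} (p-prime : Prime p) where

  private instance
    p≢0 : NonZero p
    p≢0 = prime⇒nonZero p-prime

  open Congruence p

  -- The first row vanishes off the diagonal, so the equations for j > 0 determine c ∘ suc;
  -- the equation for j = 0 then determines c 0.
  triangular-cancel : ∀ {s} (M : Fin s → Fin s → ℕ) → (∀ i → M i i ≉ 0) → (∀ {i j} → i Fin.< j → M i j ≈ 0) →
                      (c c′ : Fin s → ℕ) → (∀ j → ∑[ i < s ] (c i * M i j) ≈ ∑[ i < s ] (c′ i * M i j)) →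
                      ∀ i → c i ≈ c′ i
  triangular-cancel {zero}  _ _        _     _ _  _   ()
  triangular-cancel {suc s} M diagonal upper c c′ eqs = λ where
      zero    → *-cancelʳ-≈ p-prime (diagonal zero) (+-cancelʳ-≈ tails≈ (eqs zero))
      (suc i) → c₊≈c′₊ i
    where
    a*first-row≈0 : ∀ a j → a * M zero (suc j) ≈ 0
    a*first-row≈0 a j = ≈-trans (*-cong (≈-refl {a}) (upper {zero} {suc j} z<s)) (≈-reflexive (*-zeroʳ a))
    c₊≈c′₊ : ∀ i → c (suc i) ≈ c′ (suc i)
    c₊≈c′₊ = triangular-cancel (λ i j → M (suc i) (suc j)) (diagonal ∘ suc) (λ i<j → upper (s<s i<j))
               (c ∘ suc) (c′ ∘ suc)
               (λ j → +-cancelˡ-≈ (≈-trans (a*first-row≈0 (c zero) j) (≈-sym (a*first-row≈0 (c′ zero) j))) (eqs (suc j)))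
    tails≈ : ∑[ i < s ] (c (suc i) * M (suc i) zero) ≈ ∑[ i < s ] (c′ (suc i) * M (suc i) zero)
    tails≈ = sum-cong-≈ (λ i → *-cong (c₊≈c′₊ i) (≈-refl {M (suc i) zero}))

  triangular⋆⇒≤ : ∀ {s N} (A : Fin s → Fin N → ℕ) (B : Fin N → Fin s → ℕ) →
                  (∀ i → (A ⋆ B) i i ≉ 0) → (∀ {i j} → i Fin.< j → (A ⋆ B) i j ≈ 0) → s ≤ N
  triangular⋆⇒≤ {s} {N} A B diagonal upper =
    ≗-injective⇒≤ (nonTrivial⇒n>1 p {{prime⇒nonTrivial p-prime}}) Φ Φ-injective
    where
    Φ : (Fin s → Fin p) → Fin N → Fin p
    Φ c t = (∑[ i < s ] (toℕ (c i) * A i t)) mod p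
    Φ-injective : Injective _≗_ _≗_ Φ
    Φ-injective {c} {c′} Φc≗Φc′ =
      toℕ-≈-injective ∘ triangular-cancel (A ⋆ B) diagonal upper (toℕ ∘ c) (toℕ ∘ c′) same-products
      where
      same-products : ∀ j → ∑[ i < s ] (toℕ (c i) * (A ⋆ B) i j) ≈ ∑[ i < s ] (toℕ (c′ i) * (A ⋆ B) i j)
      same-products j = begin
        ∑[ i < s ] (toℕ (c i) * (A ⋆ B) i j)                  ≡⟨ ∑-*-⋆ (toℕ ∘ c) A B j ⟨
        ∑[ t < N ] (∑[ i < s ] (toℕ (c i) * A i t) * B t j)   ≈⟨ sum-cong-≈ (λ t → *-cong (mod-≡⇒≈ (Φc≗Φc′ t)) ≈-refl) ⟩
        ∑[ t < N ] (∑[ i < s ] (toℕ (c′ i) * A i t) * B t j)  ≡⟨ ∑-*-⋆ (toℕ ∘ c′) A B j ⟩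
        ∑[ i < s ] (toℕ (c′ i) * (A ⋆ B) i j)                 ∎
        where open ≈-Reasoning

-- Binomial coefficients and interpolation in the binomial basis

C-pascal : ∀ n k → suc n C suc k ≡ n C k + n C suc k
C-pascal n k = sym (nCk+nC[k+1]≡[n+1]C[k+1] n k)

[1+k]*[1+n]C[1+k]≡[1+n]*nCk : ∀ n k → suc k * (suc n C suc k) ≡ suc n * (n C k)
[1+k]*[1+n]C[1+k]≡[1+n]*nCk n       zero    =
  trans (*-identityˡ (suc n C 1)) (trans (nC1≡n (suc n)) (sym (*-identityʳ (suc n))))
[1+k]*[1+n]C[1+k]≡[1+n]*nCk zero    (suc k) = *-zeroʳ (suc (suc k))
[1+k]*[1+n]C[1+k]≡[1+n]*nCk (suc n) (suc k) = begin
  suc (suc k) * (suc (suc n) C suc (suc k))   ≡⟨ cong (suc (suc k) *_) (C-pascal (suc n) (suc k)) ⟩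
  suc (suc k) * (A + X)                       ≡⟨ *-distribˡ-+ (suc (suc k)) A X ⟩
  A + suc k * A + suc (suc k) * X             ≡⟨ cong₂ (λ u v → A + u + v)
                                                   ([1+k]*[1+n]C[1+k]≡[1+n]*nCk n k)
                                                   ([1+k]*[1+n]C[1+k]≡[1+n]*nCk n (suc k)) ⟩
  A + suc n * (n C k) + suc n * (n C suc k)   ≡⟨ +-assoc A (suc n * (n C k)) _ ⟩
  A + (suc n * (n C k) + suc n * (n C suc k)) ≡⟨ cong (A +_) (*-distribˡ-+ (suc n) (n C k) (n C suc k)) ⟨
  A + suc n * (n C k + n C suc k)             ≡⟨ cong (λ u → A + suc n * u) (C-pascal n k) ⟨
  A + suc n * A                               ∎
  where
  open ≡-Reasoning
  A X : ℕ
  A = suc n C suc k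
  X = suc n C suc (suc k)

poly : (ℕ → ℕ) → ℕ → ℕ → ℕ
poly b d m = ∑[ j < d ] (b (toℕ j) * (m C toℕ j))

poly-init-last : ∀ b d m → poly b (suc d) m ≡ poly b d m + b d * (m C d)
poly-init-last b d m = begin
  poly b (suc d) m
    ≡⟨ sum-init-last (λ j → b (toℕ j) * (m C toℕ j)) ⟩
  ∑[ j < d ] (b (toℕ (inject₁ j)) * (m C toℕ (inject₁ j))) + b (toℕ (fromℕ d)) * (m C toℕ (fromℕ d))
    ≡⟨ cong₂ _+_ (sum-cong-≗ {d} (cong term ∘ toℕ-inject₁)) (cong term (toℕ-fromℕ d)) ⟩
  poly b d m + b d * (m C d)
    ∎
  where
  open ≡-Reasoning
  term : ℕ → ℕ
  term j = b j * (m C j)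

poly-at-0 : ∀ b d → poly b (suc d) 0 ≡ b 0
poly-at-0 b d = begin
  b 0 * 1 + ∑[ j < d ] (b (suc (toℕ j)) * 0)   ≡⟨ cong₂ _+_ (*-identityʳ (b 0)) (sum-cong-≗ {d} (*-zeroʳ ∘ b ∘ suc ∘ toℕ)) ⟩
  b 0 + ∑[ j < d ] 0                           ≡⟨ cong (b 0 +_) (sum-replicate-zero d) ⟩
  b 0 + 0                                      ≡⟨ +-identityʳ (b 0) ⟩
  b 0                                          ∎
  where open ≡-Reasoning

poly-at-suc : ∀ b d m → poly b (suc d) (suc m) ≡ poly b (suc d) m + poly (b ∘ suc) d m
poly-at-suc b d m = begin
  b 0 * 1 + ∑[ j < d ] (c j * (suc m C suc (toℕ j)))
    ≡⟨ cong (b 0 * 1 +_) (sum-cong-≗ {d} pascal) ⟩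
  b 0 * 1 + ∑[ j < d ] (c j * (m C toℕ j) + c j * (m C suc (toℕ j)))
    ≡⟨ cong (b 0 * 1 +_) (∑-distrib-+ (λ j → c j * (m C toℕ j)) _) ⟩
  b 0 * 1 + (P + R)
    ≡⟨ cong (b 0 * 1 +_) (+-comm P R) ⟩
  b 0 * 1 + (R + P)
    ≡⟨ +-assoc (b 0 * 1) R P ⟨
  b 0 * 1 + R + P
    ∎
  where
  open ≡-Reasoning
  c : Fin d → ℕ
  c j = b (suc (toℕ j))
  pascal : ∀ j → c j * (suc m C suc (toℕ j)) ≡ c j * (m C toℕ j) + c j * (m C suc (toℕ j))
  pascal j = trans (cong (c j *_) (C-pascal m (toℕ j))) (*-distribˡ-+ (c j) _ _)
  P R : ℕ
  P = poly (b ∘ suc) d m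
  R = ∑[ j < d ] (c j * (m C suc (toℕ j)))

module Newton (d : ℕ) .{{_ : NonZero d}} where

  open Congruence d

  Δ : (ℕ → ℕ) → ℕ → ℕ
  Δ ψ m = ψ (suc m) + negate (ψ m)

  newtonCoeff : (ℕ → ℕ) → ℕ → ℕ
  newtonCoeff ψ zero    = ψ 0
  newtonCoeff ψ (suc j) = newtonCoeff (Δ ψ) j

  newton-interpolation : ∀ ψ {e m} → m < e → poly (newtonCoeff ψ) e m ≈ ψ m
  newton-interpolation ψ {suc e} {zero}  _         = ≈-reflexive (poly-at-0 (newtonCoeff ψ) e)
  newton-interpolation ψ {suc e} {suc m} (s≤s m<e) = begin
    poly b (suc e) (suc m)                  ≡⟨ poly-at-suc b e m ⟩
    poly b (suc e) m + poly (b ∘ suc) e m   ≈⟨ +-cong (newton-interpolation ψ (m<n⇒m<1+n m<e))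
                                                       (newton-interpolation (Δ ψ) m<e) ⟩
    ψ m + (ψ (suc m) + negate (ψ m))        ≡⟨ x+[y+z]≡y+[x+z] (ψ m) (ψ (suc m)) _ ⟩
    ψ (suc m) + (ψ m + negate (ψ m))        ≈⟨ +-cong (≈-refl {ψ (suc m)}) (+-inverseʳ (ψ m)) ⟩
    ψ (suc m) + 0                           ≡⟨ +-identityʳ (ψ (suc m)) ⟩
    ψ (suc m)                               ∎
    where
    open ≈-Reasoning
    b : ℕ → ℕ
    b = newtonCoeff ψ

-- Counting small subsets

sumˡ-map-++ : ∀ {A : Set} (f : A → ℕ) xs ys → sumˡ (map f (xs ++ ys)) ≡ sumˡ (map f xs) + sumˡ (map f ys)
sumˡ-map-++ f xs ys = trans (cong sumˡ (map-++ f xs ys)) (sum-++ (map f xs) (map f ys))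

sumˡ-map-∘ : ∀ {A B : Set} (f : B → ℕ) (g : A → B) xs → sumˡ (map f (map g xs)) ≡ sumˡ (map (f ∘ g) xs)
sumˡ-map-∘ f g xs = cong sumˡ (sym (map-∘ xs))

sumˡ-map-0 : ∀ {A : Set} {f : A → ℕ} xs → (∀ x → f x ≡ 0) → sumˡ (map f xs) ≡ 0
sumˡ-map-0 []       _   = refl
sumˡ-map-0 (x ∷ xs) f≡0 = cong₂ _+_ (f≡0 x) (sumˡ-map-0 xs f≡0)

sumˡ-map≡∑-lookup : ∀ {A : Set} (f : A → ℕ) xs → sumˡ (map f xs) ≡ ∑[ t < length xs ] f (lookup xs t)
sumˡ-map≡∑-lookup f []       = refl
sumˡ-map≡∑-lookup f (x ∷ xs) = cong (f x +_) (sumˡ-map≡∑-lookup f xs)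

sumˡ-map-∷ : ∀ {n} (f : Subset (suc n) → ℕ) (xs ys : List (Subset n)) →
             sumˡ (map f (map (outside ∷_) xs ++ map (inside ∷_) ys))
             ≡ sumˡ (map (f ∘ (outside ∷_)) xs) + sumˡ (map (f ∘ (inside ∷_)) ys)
sumˡ-map-∷ f xs ys = trans (sumˡ-map-++ f (map (outside ∷_) xs) (map (inside ∷_) ys))
                           (cong₂ _+_ (sumˡ-map-∘ f (outside ∷_) xs) (sumˡ-map-∘ f (inside ∷_) ys))

𝟙[_⊆_] : ∀ {n} → Subset n → Subset n → ℕ
𝟙[ []          ⊆ []          ] = 1
𝟙[ outside ∷ T ⊆ _ ∷ Z       ] = 𝟙[ T ⊆ Z ]
𝟙[ inside ∷ T  ⊆ inside ∷ Z  ] = 𝟙[ T ⊆ Z ]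
𝟙[ inside ∷ T  ⊆ outside ∷ Z ] = 0

𝟙[⊆∩] : ∀ {n} (T Z W : Subset n) → 𝟙[ T ⊆ Z ∩ W ] ≡ 𝟙[ T ⊆ Z ] * 𝟙[ T ⊆ W ]
𝟙[⊆∩] []            []            []            = refl
𝟙[⊆∩] (outside ∷ T) (_ ∷ Z)       (_ ∷ W)       = 𝟙[⊆∩] T Z W
𝟙[⊆∩] (inside ∷ T)  (inside ∷ Z)  (inside ∷ W)  = 𝟙[⊆∩] T Z W
𝟙[⊆∩] (inside ∷ T)  (inside ∷ Z)  (outside ∷ W) = sym (*-zeroʳ 𝟙[ T ⊆ Z ])
𝟙[⊆∩] (inside ∷ T)  (outside ∷ Z) (_ ∷ W)       = refl

subsets : (n j : ℕ) → List (Subset n)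
subsets zero    zero    = [] ∷ []
subsets zero    (suc j) = []
subsets (suc n) zero    = map (outside ∷_) (subsets n zero)
subsets (suc n) (suc j) = map (outside ∷_) (subsets n (suc j)) ++ map (inside ∷_) (subsets n j)

smallSubsets : (n d : ℕ) → List (Subset n)
smallSubsets n zero    = []
smallSubsets n (suc d) = smallSubsets n d ++ subsets n d

length-subsets : ∀ n j → length (subsets n j) ≡ n C j
length-subsets zero    zero    = refl
length-subsets zero    (suc j) = refl
length-subsets (suc n) zero    = trans (length-map (outside ∷_) (subsets n zero)) (length-subsets n zero)
length-subsets (suc n) (suc j) = begin
  length (map (outside ∷_) (subsets n (suc j)) ++ map (inside ∷_) (subsets n j))
    ≡⟨ length-++ (map (outside ∷_) (subsets n (suc j))) ⟩
  length (map (outside ∷_) (subsets n (suc j))) + length (map (inside ∷_) (subsets n j))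
    ≡⟨ cong₂ _+_ (length-map (outside ∷_) (subsets n (suc j))) (length-map (inside ∷_) (subsets n j)) ⟩
  length (subsets n (suc j)) + length (subsets n j)
    ≡⟨ cong₂ _+_ (length-subsets n (suc j)) (length-subsets n j) ⟩
  n C suc j + n C j
    ≡⟨ +-comm (n C suc j) (n C j) ⟩
  n C j + n C suc j
    ≡⟨ C-pascal n j ⟨
  suc n C suc j
    ∎
  where open ≡-Reasoning

length-smallSubsets : ∀ n d → length (smallSubsets n d) ≡ binomSum n d
length-smallSubsets n zero    = refl
length-smallSubsets n (suc d) =
  trans (length-++ (smallSubsets n d)) (cong₂ _+_ (length-smallSubsets n d) (length-subsets n d))

∑-subsets : ∀ {n} j (w : ℕ → ℕ) (Z : Subset n) →
            sumˡ (map (λ T → w ∣ T ∣ * 𝟙[ T ⊆ Z ]) (subsets n j)) ≡ w j * (∣ Z ∣ C j)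
∑-subsets         zero    w []            = +-identityʳ (w 0 * 1)
∑-subsets         (suc j) w []            = sym (*-zeroʳ (w (suc j)))
∑-subsets {suc n} zero    w (z ∷ Z)       =
  trans (sumˡ-map-∘ (λ T → w ∣ T ∣ * 𝟙[ T ⊆ z ∷ Z ]) (outside ∷_) (subsets n zero)) (∑-subsets zero w Z)
∑-subsets {suc n} (suc j) w (inside ∷ Z)  = begin
  sumˡ (map f (map (outside ∷_) (subsets n (suc j)) ++ map (inside ∷_) (subsets n j)))
    ≡⟨ sumˡ-map-∷ f (subsets n (suc j)) (subsets n j) ⟩
  sumˡ (map (f ∘ (outside ∷_)) (subsets n (suc j))) + sumˡ (map (f ∘ (inside ∷_)) (subsets n j))
    ≡⟨ cong₂ _+_ (∑-subsets (suc j) w Z) (∑-subsets j (w ∘ suc) Z) ⟩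
  w (suc j) * (∣ Z ∣ C suc j) + w (suc j) * (∣ Z ∣ C j)
    ≡⟨ *-distribˡ-+ (w (suc j)) (∣ Z ∣ C suc j) (∣ Z ∣ C j) ⟨
  w (suc j) * (∣ Z ∣ C suc j + ∣ Z ∣ C j)
    ≡⟨ cong (w (suc j) *_) (trans (+-comm (∣ Z ∣ C suc j) (∣ Z ∣ C j)) (sym (C-pascal ∣ Z ∣ j))) ⟩
  w (suc j) * (suc ∣ Z ∣ C suc j)
    ∎
  where
  open ≡-Reasoning
  f : Subset (suc n) → ℕ
  f T = w ∣ T ∣ * 𝟙[ T ⊆ inside ∷ Z ]
∑-subsets {suc n} (suc j) w (outside ∷ Z) = begin
  sumˡ (map f (map (outside ∷_) (subsets n (suc j)) ++ map (inside ∷_) (subsets n j)))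
    ≡⟨ sumˡ-map-∷ f (subsets n (suc j)) (subsets n j) ⟩
  sumˡ (map (f ∘ (outside ∷_)) (subsets n (suc j))) + sumˡ (map (f ∘ (inside ∷_)) (subsets n j))
    ≡⟨ cong₂ _+_ (∑-subsets (suc j) w Z) (sumˡ-map-0 (subsets n j) (*-zeroʳ ∘ w ∘ suc ∘ ∣_∣)) ⟩
  w (suc j) * (∣ Z ∣ C suc j) + 0
    ≡⟨ +-identityʳ _ ⟩
  w (suc j) * (∣ Z ∣ C suc j)
    ∎
  where
  open ≡-Reasoning
  f : Subset (suc n) → ℕ
  f T = w ∣ T ∣ * 𝟙[ T ⊆ outside ∷ Z ]

∑-smallSubsets : ∀ {n} d (w : ℕ → ℕ) (Z : Subset n) →
                 sumˡ (map (λ T → w ∣ T ∣ * 𝟙[ T ⊆ Z ]) (smallSubsets n d)) ≡ poly w d ∣ Z ∣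
∑-smallSubsets zero    w Z = refl
∑-smallSubsets (suc d) w Z = begin
  sumˡ (map f (smallSubsets _ d ++ subsets _ d))
    ≡⟨ sumˡ-map-++ f (smallSubsets _ d) (subsets _ d) ⟩
  sumˡ (map f (smallSubsets _ d)) + sumˡ (map f (subsets _ d))
    ≡⟨ cong₂ _+_ (∑-smallSubsets d w Z) (∑-subsets d w Z) ⟩
  poly w d ∣ Z ∣ + w d * (∣ Z ∣ C d)
    ≡⟨ poly-init-last w d ∣ Z ∣ ⟨
  poly w (suc d) ∣ Z ∣
    ∎
  where
  open ≡-Reasoning
  f : Subset _ → ℕ
  f T = w ∣ T ∣ * 𝟙[ T ⊆ Z ]

record Triangular {n s} (Good : Subset n → Set) (test : Fin s → Subset n) : Set where
  field
    support      : Fin s → Subset n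
    bad-diagonal : ∀ i → ¬ Good (test i ∩ support i)
    good-above   : ∀ {i j} → i Fin.< j → Good (test j ∩ support i)

triangular-[] : ∀ {n} {Good : Subset n → Set} {test : Fin 0 → Subset n} → Triangular Good test
triangular-[] = record { support = λ () ; bad-diagonal = λ () ; good-above = λ { {()} } }

triangular-∷ : ∀ {n s} {Good : Subset n → Set} {test : Fin (suc s) → Subset n} {Y : Subset n} →
               Triangular Good (test ∘ suc) → ¬ Good (test zero ∩ Y) → (∀ j → Good (test (suc j) ∩ Y)) →
               Triangular Good test
triangular-∷ {Good = Good} {test} {Y} T head-bad tail-good = record
  { support = Y ∷ᶠ support ; bad-diagonal = diagonal ; good-above = above }
  where
  open Triangular T
  diagonal : ∀ i → ¬ Good (test i ∩ (Y ∷ᶠ support) i)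
  diagonal zero    = head-bad
  diagonal (suc i) = bad-diagonal i
  above : ∀ {i j} → i Fin.< j → Good (test j ∩ (Y ∷ᶠ support) i)
  above {zero}  {suc j} _         = tail-good j
  above {suc i} {suc j} (s<s i<j) = good-above i<j

-- Binomial polynomials modulo a prime power

module _ {p : ℕ} (p-prime : Prime p) where

  private instance
    p≢0 : NonZero p
    p≢0 = prime⇒nonZero p-prime

  p^α∣m*n∧p∤n⇒p^α∣m : ∀ α {m n} → p ^ α ∣ m * n → ¬ p ∣ n → p ^ α ∣ m
  p^α∣m*n∧p∤n⇒p^α∣m zero    _   _   = 1∣ _
  p^α∣m*n∧p∤n⇒p^α∣m (suc α) {m} {n} dvd p∤n with euclidsLemma m n p-prime (∣-trans (m∣m*n (p ^ α)) dvd)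
  ... | inj₂ p∣n               = contradiction p∣n p∤n
  ... | inj₁ (divides m′ refl) =
    subst (p ^ suc α ∣_) (*-comm p m′) (*-monoʳ-∣ p (p^α∣m*n∧p∤n⇒p^α∣m α p^α∣m′*n p∤n))
    where
    p^α∣m′*n : p ^ α ∣ m′ * n
    p^α∣m′*n = *-cancelˡ-∣ p (subst (p ^ suc α ∣_) (trans (cong (_* n) (*-comm m′ p)) (*-assoc p m′ n)) dvd)

  p∣[p^α]Cj : ∀ α {j} → 0 < j → j < p ^ α → p ∣ p ^ α C j
  p∣[p^α]Cj α {suc j} _ j<q with p ∣? p ^ α C suc j
  ... | yes p∣C = p∣C
  ... | no  p∤C = contradiction (∣⇒≤ (p^α∣m*n∧p∤n⇒p^α∣m α q∣[1+j]*C p∤C)) (<⇒≱ j<q)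
    where
    q : ℕ
    q = p ^ α
    instance
      q≢0 : NonZero q
      q≢0 = m^n≢0 p α
    q∣[1+j]*C : q ∣ suc j * (q C suc j)
    q∣[1+j]*C = divides (pred q C j) (begin
      suc j * (q C suc j)              ≡⟨ cong (λ u → suc j * (u C suc j)) (suc-pred q) ⟨
      suc j * (suc (pred q) C suc j)   ≡⟨ [1+k]*[1+n]C[1+k]≡[1+n]*nCk (pred q) j ⟩
      suc (pred q) * (pred q C j)      ≡⟨ cong (_* (pred q C j)) (suc-pred q) ⟩
      q * (pred q C j)                 ≡⟨ *-comm q (pred q C j) ⟩
      (pred q C j) * q                 ∎)
      where open ≡-Reasoning

module _ {p : ℕ} (p-prime : Prime p) (α : ℕ) where

  private
    q : ℕ
    q = p ^ α
    instance
      p≢0 : NonZero p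
      p≢0 = prime⇒nonZero p-prime
      q≢0 : NonZero q
      q≢0 = m^n≢0 p α

  open Congruence p
  open Newton p

  C-periodic : ∀ m {j} → j < q → (m + q) C j ≈ m C j
  C-periodic m       {zero}  _   = ≈-refl
  C-periodic zero    {suc j} j<q = ∣⇒≈0 (p∣[p^α]Cj p-prime α z<s j<q)
  C-periodic (suc m) {suc j} j<q = begin
    suc (m + q) C suc j             ≡⟨ C-pascal (m + q) j ⟩
    (m + q) C j + (m + q) C suc j   ≈⟨ +-cong (C-periodic m (<-trans (n<1+n j) j<q)) (C-periodic m j<q) ⟩
    m C j + m C suc j               ≡⟨ C-pascal m j ⟨
    suc m C suc j                   ∎
    where open ≈-Reasoning

  poly-periodic : ∀ b m → poly b q (m + q) ≈ poly b q m
  poly-periodic b m = sum-cong-≈ λ j → *-cong (≈-refl {b (toℕ j)}) (C-periodic m (toℕ<n j))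

  poly-+-multiple : ∀ b r t → poly b q (r + t * q) ≈ poly b q r
  poly-+-multiple b r zero    = ≈-reflexive (cong (poly b q) (+-identityʳ r))
  poly-+-multiple b r (suc t) = begin
    poly b q (r + (q + t * q))   ≡⟨ cong (poly b q) (x+[y+z]≡y+[x+z] r q (t * q)) ⟩
    poly b q (q + (r + t * q))   ≡⟨ cong (poly b q) (+-comm q (r + t * q)) ⟩
    poly b q (r + t * q + q)     ≈⟨ poly-periodic b (r + t * q) ⟩
    poly b q (r + t * q)         ≈⟨ poly-+-multiple b r t ⟩
    poly b q r                   ∎
    where open ≈-Reasoning

  newton-interpolation-mod : ∀ ψ m → poly (newtonCoeff ψ) q m ≈ ψ (m % q)
  newton-interpolation-mod ψ m = begin
    poly b q m                     ≡⟨ cong (poly b q) (m≡m%n+[m/n]*n m q) ⟩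
    poly b q (m % q + m / q * q)   ≈⟨ poly-+-multiple b (m % q) (m / q) ⟩
    poly b q (m % q)               ≈⟨ newton-interpolation ψ (m%n<n m q) ⟩
    ψ (m % q)                      ∎
    where
    open ≈-Reasoning
    b : ℕ → ℕ
    b = newtonCoeff ψ

  triangular⇒≤binomSum : ∀ {n s} {G : ℕ → Set} → Decidable G → {test : Fin s → Subset n} →
                         Triangular (λ Z → G (∣ Z ∣ % q)) test → s ≤ binomSum n q
  triangular⇒≤binomSum {n} {s} {G} G? {test} T = begin
    s                           ≤⟨ triangular⋆⇒≤ p-prime A B diagonal upper ⟩
    length (smallSubsets n q)   ≡⟨ length-smallSubsets n q ⟩
    binomSum n q                ∎
    where
    open ≤-Reasoning
    open Triangular T
    ψ : ℕ → ℕ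
    ψ r = if does (G? r) then 0 else 1
    b : ℕ → ℕ
    b = newtonCoeff ψ
    N : ℕ
    N = length (smallSubsets n q)
    small : Fin N → Subset n
    small = lookup (smallSubsets n q)
    -- Row i of A lists the coefficients of fᵢ in the monomials x_T with |T| < q; B evaluates
    -- the monomials at the test sets.
    A : Fin s → Fin N → ℕ
    A i t = b ∣ small t ∣ * 𝟙[ small t ⊆ support i ]
    B : Fin N → Fin s → ℕ
    B t j = 𝟙[ small t ⊆ test j ]
    ⋆≡poly : ∀ i j → (A ⋆ B) i j ≡ poly b q ∣ test j ∩ support i ∣
    ⋆≡poly i j = begin-equality
      ∑[ t < N ] (b ∣ small t ∣ * 𝟙[ small t ⊆ support i ] * 𝟙[ small t ⊆ test j ])
        ≡⟨ sum-cong-≗ {N} (term ∘ small) ⟩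
      ∑[ t < N ] (b ∣ small t ∣ * 𝟙[ small t ⊆ test j ∩ support i ])
        ≡⟨ sumˡ-map≡∑-lookup (λ U → b ∣ U ∣ * 𝟙[ U ⊆ test j ∩ support i ]) (smallSubsets n q) ⟨
      sumˡ (map (λ U → b ∣ U ∣ * 𝟙[ U ⊆ test j ∩ support i ]) (smallSubsets n q))
        ≡⟨ ∑-smallSubsets q b (test j ∩ support i) ⟩
      poly b q ∣ test j ∩ support i ∣
        ∎
      where
      term : ∀ U → b ∣ U ∣ * 𝟙[ U ⊆ support i ] * 𝟙[ U ⊆ test j ] ≡ b ∣ U ∣ * 𝟙[ U ⊆ test j ∩ support i ]
      term U = trans (*-assoc (b ∣ U ∣) _ _)
        (cong (b ∣ U ∣ *_) (trans (*-comm 𝟙[ U ⊆ support i ] _) (sym (𝟙[⊆∩] U (test j) (support i)))))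
    ⋆≈ψ : ∀ i j → (A ⋆ B) i j ≈ ψ (∣ test j ∩ support i ∣ % q)
    ⋆≈ψ i j = ≈-trans (≈-reflexive (⋆≡poly i j)) (newton-interpolation-mod ψ ∣ test j ∩ support i ∣)
    ψ-bad : ∀ {r} → ¬ G r → ψ r ≡ 1
    ψ-bad {r} ¬Gr = cong (if_then 0 else 1) (dec-false (G? r) ¬Gr)
    ψ-good : ∀ {r} → G r → ψ r ≡ 0
    ψ-good {r} Gr = cong (if_then 0 else 1) (dec-true (G? r) Gr)
    diagonal : ∀ i → (A ⋆ B) i i ≉ 0
    diagonal i ⋆≈0 = 1≉0 (nonTrivial⇒n>1 p {{prime⇒nonTrivial p-prime}})
      (≈-trans (≈-reflexive (sym (ψ-bad (bad-diagonal i)))) (≈-trans (≈-sym (⋆≈ψ i i)) ⋆≈0))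
    upper : ∀ {i j} → i Fin.< j → (A ⋆ B) i j ≈ 0
    upper {i} {j} i<j = ≈-trans (⋆≈ψ i j) (≈-reflexive (ψ-good (good-above i<j)))

-- Greedy decomposition into chains

x∉p-x : ∀ {n} (p : Subset n) x → x ∉ p - x
x∉p-x (_ ∷ p) zero    ()
x∉p-x (_ ∷ p) (suc x) (there x∈p-x) = x∉p-x p x x∈p-x

∣p∣≤1+∣p-x∣ : ∀ {n} (p : Subset n) x → ∣ p ∣ ≤ suc ∣ p - x ∣
∣p∣≤1+∣p-x∣ (inside ∷ p)  zero    = s≤s (≤-reflexive (cong ∣_∣ (sym (p─⊥≡p p))))
∣p∣≤1+∣p-x∣ (outside ∷ p) zero    = m≤n⇒m≤1+n (≤-reflexive (cong ∣_∣ (sym (p─⊥≡p p))))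
∣p∣≤1+∣p-x∣ (inside ∷ p)  (suc x) = s≤s (∣p∣≤1+∣p-x∣ p x)
∣p∣≤1+∣p-x∣ (outside ∷ p) (suc x) = ∣p∣≤1+∣p-x∣ p x

p∩[p∩q]≡p∩q : ∀ {n} (p q : Subset n) → p ∩ (p ∩ q) ≡ p ∩ q
p∩[p∩q]≡p∩q p q = trans (sym (∩-assoc p p q)) (cong (_∩ q) (∩-idem p))

∷-injective : ∀ {A : Set} {s} {x : A} {f : Fin s → A} →
              Injective _≡_ _≡_ f → (∀ i → x ≢ f i) → Injective _≡_ _≡_ (x ∷ᶠ f)
∷-injective f-injective x∉f {zero}  {zero}  _  = refl
∷-injective f-injective x∉f {zero}  {suc j} eq = contradiction eq (x∉f j)
∷-injective f-injective x∉f {suc i} {zero}  eq = contradiction (sym eq) (x∉f i)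
∷-injective f-injective x∉f {suc i} {suc j} eq = cong suc (f-injective eq)

module Greedy {n m : ℕ} {Good : Subset n → Set} (Good? : Decidable Good) (k : ℕ) (F : Fin m → Subset n)
              (F-bad : ∀ r → ¬ Good (F r))
              (⋂-good : (idx : Fin (suc (suc k)) → Fin m) → Injective _≡_ _≡_ idx → Good (⋂ (F ∘ idx))) where

  record Chain (P : Subset m) : Set where
    constructor chain
    field
      len           : ℕ
      idx           : Fin (suc len) → Fin m
      idx-injective : Injective _≡_ _≡_ idx
      idx∉P         : ∀ i → idx i ∉ P
      meet-bad      : ¬ Good (⋂ (F ∘ idx))

    meet : Subset n
    meet = ⋂ (F ∘ idx)

    ∷-idx-injective : ∀ {r} → r ∈ P → Injective _≡_ _≡_ (r ∷ᶠ idx)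
    ∷-idx-injective r∈P = ∷-injective idx-injective (λ i r≡idx → idx∉P i (subst (_∈ P) r≡idx r∈P))

  open Chain

  singleton : ∀ R r → Chain (R - r)
  singleton R r = chain 0 (λ _ → r) (λ { {zero} {zero} _ → refl }) (λ _ → x∉p-x R r)
                        (subst (¬_ ∘ Good) (sym (∩-identityʳ (F r))) (F-bad r))

  extend : ∀ {P r} (c : Chain P) → r ∈ P → ¬ Good (F r ∩ meet c) → Chain (P - r)
  extend {P} {r} c r∈P bad = chain (suc (len c)) (r ∷ᶠ idx c) (∷-idx-injective c r∈P) idx′∉P-r bad
    where
    idx′∉P-r : ∀ i → (r ∷ᶠ idx c) i ∉ P - r
    idx′∉P-r zero    = x∉p-x P r
    idx′∉P-r (suc i) = idx∉P c i ∘ p─q⊆p P ⁅ r ⁆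

  longest⇒saturated : ∀ {P} (c : Chain P) → len c ≡ k → ∀ {r} → r ∈ P → Good (F r ∩ meet c)
  longest⇒saturated c@(chain _ idx _ _ _) refl r∈P = ⋂-good (_ ∷ᶠ idx) (∷-idx-injective c r∈P)

  record Saturation {P} (c : Chain P) : Set where
    field
      pool      : Subset m
      maximal   : Chain pool
      pool⊆P    : pool ⊆ P
      head∈     : idx maximal zero ∈ P ⊎ idx maximal zero ≡ idx c zero
      short     : len maximal ≤ k
      size      : ∣ P ∣ + len c ≤ ∣ pool ∣ + len maximal
      saturated : ∀ {r} → r ∈ pool → Good (F r ∩ meet maximal)

  trivial-saturation : ∀ {P} (c : Chain P) → len c ≤ k → (∀ {r} → r ∈ P → Good (F r ∩ meet c)) → Saturation c
  trivial-saturation {P} c short saturated = record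
    { pool = P ; maximal = c ; pool⊆P = id ; head∈ = inj₂ refl ; short = short ; size = ≤-refl ; saturated = saturated }

  lift-saturation : ∀ {P r} (c : Chain P) (r∈P : r ∈ P) (bad : ¬ Good (F r ∩ meet c)) →
                    Saturation (extend c r∈P bad) → Saturation c
  lift-saturation {P} {r} c r∈P bad S = record
    { pool      = pool
    ; maximal   = maximal
    ; pool⊆P    = P-r⊆P ∘ pool⊆P
    ; head∈     = inj₁ ([ P-r⊆P , (λ head≡r → subst (_∈ P) (sym head≡r) r∈P) ]′ head∈)
    ; short     = short
    ; size      = ≤-trans (+-monoˡ-≤ (len c) (∣p∣≤1+∣p-x∣ P r)) (≤-trans (≤-reflexive (sym (+-suc ∣ P - r ∣ (len c)))) size)
    ; saturated = saturated
    }
    where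
    open Saturation S
    P-r⊆P : P - r ⊆ P
    P-r⊆P = p─q⊆p P ⁅ r ⁆

  saturate : ∀ {P} (c : Chain P) u → u + len c ≡ k → Saturation c
  saturate     c zero    len≡k   = trivial-saturation c (≤-reflexive len≡k) (longest⇒saturated c len≡k)
  saturate {P} c (suc u) u+len≡k with any? (λ r → r ∈? P ×-dec ¬? (Good? (F r ∩ meet c)))
  ... | yes (r , r∈P , bad) =
    lift-saturation c r∈P bad (saturate (extend c r∈P bad) u (trans (+-suc u (len c)) u+len≡k))
  ... | no  none            =
    trivial-saturation c (subst (len c ≤_) u+len≡k (m≤n+m (len c) (suc u)))
                         (λ r∈P → decidable-stable (Good? _) (λ ¬good → none (_ , r∈P , ¬good)))

  record Staircase (R : Subset m) : Set where
    field
      s          : ℕ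
      ι          : Fin s → Fin m
      ι∈R        : ∀ j → ι j ∈ R
      triangular : Triangular Good (F ∘ ι)
      size       : ∣ R ∣ ≤ suc k * s

  staircase : ∀ R → Acc _<_ ∣ R ∣ → Staircase R
  staircase R (acc rec) with nonempty? R
  ... | no R-empty = record
    { s = 0 ; ι = λ () ; ι∈R = λ () ; triangular = triangular-[]
    ; size = ≤-reflexive (trans (cong ∣_∣ (Empty-unique R-empty)) (trans (∣⊥∣≡0 m) (sym (*-zeroʳ (suc k))))) }
  ... | yes (r , r∈R) = record
    { s          = suc (s rest)
    ; ι          = head ∷ᶠ ι rest
    ; ι∈R        = λ where
        zero    → [ R-r⊆R , (λ head≡r → subst (_∈ R) (sym head≡r) r∈R) ]′ head∈
        (suc j) → R-r⊆R (pool⊆P (ι∈R rest j))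
    ; triangular = triangular-∷ (triangular rest) head-bad (λ j → saturated (ι∈R rest j))
    ; size       = begin
        ∣ R ∣                          ≤⟨ ∣p∣≤1+∣p-x∣ R r ⟩
        suc ∣ R - r ∣                  ≡⟨ cong suc (+-identityʳ ∣ R - r ∣) ⟨
        suc (∣ R - r ∣ + 0)            ≤⟨ s≤s size ⟩
        suc (∣ pool ∣ + len maximal)   ≡⟨ cong suc (+-comm ∣ pool ∣ (len maximal)) ⟩
        suc (len maximal) + ∣ pool ∣   ≤⟨ +-mono-≤ (s≤s short) (Staircase.size rest) ⟩
        suc k + suc k * s rest         ≡⟨ *-suc (suc k) (s rest) ⟨
        suc k * suc (s rest)           ∎
    }
    where
    open ≤-Reasoning
    open Saturation (saturate (singleton R r) k (+-identityʳ k))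
    open Staircase using (s; ι; ι∈R; triangular)
    R-r⊆R : R - r ⊆ R
    R-r⊆R = p─q⊆p R ⁅ r ⁆
    rest : Staircase pool
    rest = staircase pool (rec (≤-<-trans (p⊆q⇒∣p∣≤∣q∣ pool⊆P) (x∈p⇒∣p-x∣<∣p∣ r∈R)))
    head : Fin m
    head = idx maximal zero
    head-bad : ¬ Good (F head ∩ meet maximal)
    head-bad = subst (¬_ ∘ Good) (sym (p∩[p∩q]≡p∩q (F head) _)) (meet-bad maximal)

≡[mod]⇒% : ∀ {a ℓ q} .{{_ : NonZero q}} → a ≡ ℓ [mod q ] → ℓ < q → a % q ≡ ℓ
≡[mod]⇒% {a} {ℓ} {q} (x , y , a+xq≡ℓ+yq) ℓ<q = begin
  a % q             ≡⟨ [m+kn]%n≡m%n a x q ⟨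
  (a + x * q) % q   ≡⟨ cong (_% q) a+xq≡ℓ+yq ⟩
  (ℓ + y * q) % q   ≡⟨ [m+kn]%n≡m%n ℓ y q ⟩
  ℓ % q             ≡⟨ m<n⇒m%n≡m ℓ<q ⟩
  ℓ                 ∎
  where open ≡-Reasoning

≡[mod]-% : ∀ a q .{{_ : NonZero q}} → a ≡ a % q [mod q ]
≡[mod]-% a q = 0 , a / q , trans (+-identityʳ a) (m≡m%n+[m/n]*n a q)

theorem1p6 : (p α k : ℕ) → Prime p → 1 ≤ α → 2 ≤ k →
    (L : List ℕ) → Unique L → All (λ ℓ → ℓ < p ^ α) L →
    length L < p ^ α → 0 < length L →
    (n : ℕ) → 0 < n →
    (𝓕 : List (Subset n)) → Unique 𝓕 →
    All (λ F → All (λ ℓ → ¬ (∣ F ∣ ≡ ℓ [mod p ^ α ])) L) 𝓕 →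
    ((idx : Fin k → Fin (length 𝓕)) → Injective _≡_ _≡_ idx →
      Any (λ ℓ → ∣ ⋂ (λ i → lookup 𝓕 (idx i)) ∣ ≡ ℓ [mod p ^ α ]) L) →
    length 𝓕 ≤ (k ∸ 1) * binomSum n (p ^ α)
theorem1p6 _ _ zero          _       _ ()       _ _ _   _ _ _ _ _ _ _             _
theorem1p6 _ _ (suc zero)    _       _ (s≤s ()) _ _ _   _ _ _ _ _ _ _             _
theorem1p6 p α (suc (suc k)) p-prime _ _        L _ L<q _ _ n _ 𝓕 _ sizes-avoid-L meets-hit-L = begin
  length 𝓕                     ≡⟨ ∣⊤∣≡n (length 𝓕) ⟨
  ∣ ⊤ {length 𝓕} ∣             ≤⟨ size ⟩
  suc k * s                    ≤⟨ *-monoʳ-≤ (suc k) (triangular⇒≤binomSum p-prime α (_∈ˡ? L) triangular) ⟩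
  suc k * binomSum n (p ^ α)   ∎
  where
  open ≤-Reasoning
  instance
    q≢0 : NonZero (p ^ α)
    q≢0 = m^n≢0 p α {{prime⇒nonZero p-prime}}
  Good : Subset n → Set
  Good Z = ∣ Z ∣ % p ^ α ∈ˡ L
  Good? : Decidable Good
  Good? Z = ∣ Z ∣ % p ^ α ∈ˡ? L
  F-bad : ∀ r → ¬ Good (lookup 𝓕 r)
  F-bad r ∈L = All.lookup (All.lookup sizes-avoid-L (∈-lookup r)) ∈L (≡[mod]-% ∣ lookup 𝓕 r ∣ (p ^ α))
  ⋂-good : (idx : Fin (suc (suc k)) → Fin (length 𝓕)) → Injective _≡_ _≡_ idx → Good (⋂ (lookup 𝓕 ∘ idx))
  ⋂-good idx idx-injective with find (meets-hit-L idx idx-injective)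
  ... | ℓ , ℓ∈L , ⋂≡ℓ = subst (_∈ˡ L) (sym (≡[mod]⇒% ⋂≡ℓ (All.lookup L<q ℓ∈L))) ℓ∈L
  open Greedy.Staircase (Greedy.staircase Good? k (lookup 𝓕) F-bad ⋂-good ⊤ (<-wellFounded _))
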